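{- Fix $k\ge2$ and write $A_xy=A_x(k,y)$. Let $m\equiv_k A_ab$ (i.e. with $c=0$), with $k$-sandwiching sequence $(a_i,b_i)_{i=1}^n$ and sandwiching values $m_0,\dots,m_n$; let $0\le j\le n$, let $d,e$ be natural numbers, and let $w=A_de$. Suppose that (1) $A_dm_j\le w<A_{d+1}m_j$, and (2) if $j>0$ then $w<A_{a_j}(b_j+1)$. Then $w\equiv_k A_de$, and the $k$-sandwiching sequence of $w$ is $(d_i,e_i)_{i=1}^{j+1}$ where $d_i=a_i$, $e_i=b_i$ for $1\le i\le j$, $d_{j+1}=d$ and $e_{j+1}=e$.
   Context: Ackermann function: for $k\ge 2$, $a,b\ge 0$: $A_a(k,-1):=1$, $A_0(k,b):=k^b$, $A_{a+1}(k,b):=A_a(k,\cdot)^k(A_{a+1}(k,b-1))$, with $f^j$ the $j$-fold iterate. $k$-normal form and sandwiching: for $m>0$ and naturals $a,b,c$, $m\equiv_k A_ab+c$ means $m=A_ab+c$ and there exist $n\ge1$ and naturals $a_1,\dots,a_n$, $b_1,\dots,b_n$, $m_0,\dots,m_n$ (sandwiching values) with $m_0=0$; for $0\le i<n$: $A_{a_{i+1}}m_i\le m<A_{a_{i+1}+1}m_i$, $A_{a_{i+1}}b_{i+1}\le m<A_{a_{i+1}}(b_{i+1}+1)$, $m_{i+1}=A_{a_{i+1}}b_{i+1}$; $A_0m_n>m$; $a=a_n$, $b=b_n$. The sequence $(a_i,b_i)_{i=1}^n$ is the $k$-sandwiching sequence of $m$ (unique). -}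

module Defs where

open import Data.Nat using (ℕ; zero; suc; _+_; _^_; _≤_; _<_)
open import Data.Product using (_×_; _,_; Σ; ∃)
open import Data.List using (List; []; _∷_; _++_; [_])
open import Relation.Binary.PropositionalEquality using (_≡_; _≢_)

iter : ℕ → (ℕ → ℕ) → ℕ → ℕ
iter zero    f x = x
iter (suc j) f x = f (iter j f x)

-- Ackermann function A a k b = A_a(k,b) for b ≥ 0.
-- The paper's A_a(k,-1) = 1 is inlined in the case b = 0:
--   A_{a+1}(k,0) = A_a(k,·)^k (A_{a+1}(k,-1)) = A_a(k,·)^k (1).
Ack : ℕ → ℕ → ℕ → ℕ
Ack k zero    b       = k ^ b
Ack k (suc a) zero    = iter k (Ack k a) 1
Ack k (suc a) (suc b) = iter k (Ack k a) (Ack k (suc a) b)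

-- SandwichFrom k m prev s : the list s = (a_{i+1},b_{i+1}),…,(a_n,b_n) satisfies the
-- sandwiching conditions for m, starting from sandwiching value prev = m_i.
SandwichFrom : ℕ → ℕ → ℕ → List (ℕ × ℕ) → Set
SandwichFrom k m prev []            = m < Ack k 0 prev
SandwichFrom k m prev ((a , b) ∷ s) =
  (Ack k a prev ≤ m × m < Ack k (suc a) prev) ×
  (Ack k a b ≤ m × m < Ack k a (suc b)) ×
  SandwichFrom k m (Ack k a b) s

IsSandwichSeq : ℕ → ℕ → List (ℕ × ℕ) → Set
IsSandwichSeq k m s = (s ≢ []) × SandwichFrom k m 0 s

NormalForm : ℕ → ℕ → ℕ → ℕ → ℕ → Set
NormalForm k m a b c =
  (0 < m) × (m ≡ Ack k a b + c) ×
  Σ (List (ℕ × ℕ)) λ pre → IsSandwichSeq k m (pre ++ [ (a , b) ])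

-- last sandwiching value of a prefix: lastVal k 0 (take j s) = m_j
lastVal : ℕ → ℕ → List (ℕ × ℕ) → ℕ
lastVal k prev []            = prev
lastVal k prev ((a , b) ∷ s) = lastVal k (Ack k a b) s

module Submission where

-- Every sandwiching value m_i (i ≤ j) is at most m_j ≤ A_d m_j ≤ w, which gives the lower
-- sandwiching bounds for w. For the upper ones, the bounds A_{a_i}(b_i+1) of m decrease
-- along its sandwiching sequence: if a_{i+1} > a_i then A_{a_{i+1}}(A_{a_i} b_i) would exceed
-- A_{a_i}(b_i+1) > m, and otherwise A_{a_i}(b_i+1) is a value of A_{a_{i+1}} lying above
-- A_{a_{i+1}} b_{i+1}. So hypothesis (2) bounds w by every A_{a_i}(b_i+1), and this is below
-- A_{a_i+1} m_{i-1}, since the values of A_{a+1} are values of A_a.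

open import Defs
open import Data.Nat using (ℕ; zero; suc; _^_; _≤_; _<_; _≤′_; ≤′-refl; ≤′-step; z≤n; s≤s; z<s; _≤?_)
open import Data.Nat.Properties
open import Data.Product using (_×_; _,_; ∃)
open import Data.List using (List; []; _∷_; _++_; [_]; take; length)
open import Data.List.Properties using (++-conicalʳ)
open import Function using (case_of_)
open import Relation.Nullary using (yes; no)
open import Relation.Nullary.Negation using (contradiction)
open import Relation.Binary.PropositionalEquality using (_≡_; refl; sym; trans; cong)

iter-inflationary : ∀ {f} → (∀ x → x ≤ f x) → ∀ j x → x ≤ iter j f x
iter-inflationary f-infl zero    x = ≤-refl
iter-inflationary f-infl (suc j) x = ≤-trans (iter-inflationary f-infl j x) (f-infl _)

iter-strictly-inflationary : ∀ {f j} → (∀ x → x < f x) → 0 < j → ∀ x → x < iter j f x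
iter-strictly-inflationary {j = suc j} f-infl _ x =
  ≤-<-trans (iter-inflationary (λ y → <⇒≤ (f-infl y)) j x) (f-infl _)

f≤iter : ∀ {f j} → (∀ {x y} → x ≤ y → f x ≤ f y) → (∀ x → x ≤ f x) → 0 < j →
              ∀ x → f x ≤ iter j f x
f≤iter {j = suc j} f-mono f-infl _ x = f-mono (iter-inflationary f-infl j x)

iter-image : ∀ {f j} → 0 < j → ∀ x → ∃ λ y → iter j f x ≡ f y
iter-image {f} {suc j} _ x = iter j f x , refl

module _ {k : ℕ} (1<k : 1 < k) where

  private
    A : ℕ → ℕ → ℕ
    A = Ack k

    0<k : 0 < k
    0<k = <-trans z<s 1<k

  n<k^n : ∀ n → n < k ^ n
  n<k^n zero    = z<s
  n<k^n (suc n) = <-≤-trans (s≤s (n<k^n n)) (^-monoʳ-< k 1<k (n<1+n n))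

  n<Ack : ∀ a n → n < A a n
  n<Ack zero    n       = n<k^n n
  n<Ack (suc a) zero    = <-≤-trans z<s (iter-inflationary (λ x → <⇒≤ (n<Ack a x)) k 1)
  n<Ack (suc a) (suc n) =
    ≤-<-trans (n<Ack (suc a) n) (iter-strictly-inflationary (n<Ack a) 0<k _)

  n≤Ack : ∀ a n → n ≤ A a n
  n≤Ack a n = <⇒≤ (n<Ack a n)

  Ack-<-suc : ∀ a n → A a n < A a (suc n)
  Ack-<-suc zero    n = ^-monoʳ-< k 1<k (n<1+n n)
  Ack-<-suc (suc a) n = iter-strictly-inflationary (n<Ack a) 0<k _

  Ack-monoʳ-≤ : ∀ a {m n} → m ≤ n → A a m ≤ A a n
  Ack-monoʳ-≤ a m≤n = go (≤⇒≤′ m≤n)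
    where
    go : ∀ {m n} → m ≤′ n → A a m ≤ A a n
    go ≤′-refl       = ≤-refl
    go (≤′-step m≤n) = ≤-trans (go m≤n) (<⇒≤ (Ack-<-suc a _))

  Ack-cancelʳ-< : ∀ a {m n} → A a m < A a n → m < n
  Ack-cancelʳ-< a p = ≰⇒> (λ n≤m → <⇒≱ p (Ack-monoʳ-≤ a n≤m))

  Ack-<⇒suc-≤ : ∀ a {m n} → A a m < A a n → A a (suc m) ≤ A a n
  Ack-<⇒suc-≤ a p = Ack-monoʳ-≤ a (Ack-cancelʳ-< a p)

  Ack-≤-Ack-suc : ∀ a n → A a n ≤ A (suc a) n
  Ack-≤-Ack-suc a zero    =
    ≤-trans (Ack-monoʳ-≤ a z≤n) (f≤iter (Ack-monoʳ-≤ a) (n≤Ack a) 0<k 1)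
  Ack-≤-Ack-suc a (suc n) =
    ≤-trans (Ack-monoʳ-≤ a (n<Ack (suc a) n)) (f≤iter (Ack-monoʳ-≤ a) (n≤Ack a) 0<k _)

  Ack-monoˡ-≤ : ∀ {a b} → a ≤ b → ∀ n → A a n ≤ A b n
  Ack-monoˡ-≤ a≤b n = go (≤⇒≤′ a≤b)
    where
    go : ∀ {a b} → a ≤′ b → A a n ≤ A b n
    go ≤′-refl       = ≤-refl
    go (≤′-step a≤b) = ≤-trans (go a≤b) (Ack-≤-Ack-suc _ n)

  Ack-image-suc : ∀ a n → ∃ λ y → A (suc a) n ≡ A a y
  Ack-image-suc a zero    = iter-image 0<k 1
  Ack-image-suc a (suc n) = iter-image 0<k _

  Ack-image-antitone : ∀ {a b} → a ≤ b → ∀ n → ∃ λ y → A b n ≡ A a y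
  Ack-image-antitone a≤b = go (≤⇒≤′ a≤b)
    where
    go : ∀ {a b} → a ≤′ b → ∀ n → ∃ λ y → A b n ≡ A a y
    go ≤′-refl n = n , refl
    go (≤′-step {b} a≤b) n with Ack-image-suc b n
    ... | y , eq with go a≤b y
    ...   | z , eq′ = z , trans eq eq′

  Ack-<-suc-level⇒suc-≤ : ∀ a {n x} → A a n < A (suc a) x → A a (suc n) ≤ A (suc a) x
  Ack-<-suc-level⇒suc-≤ a {x = x} p with Ack-image-suc a x
  ... | y , eq rewrite eq = Ack-<⇒suc-≤ a p

  Ack-suc-≤-suc-level : ∀ a n → A a (suc n) ≤ A (suc a) (A a n)
  Ack-suc-≤-suc-level a n = ≤-trans (Ack-monoʳ-≤ a (n<Ack a n)) (Ack-≤-Ack-suc a _)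

  Ack-sandwich⇒≤ : ∀ a {x y m} → A a x ≤ m → m < A a (suc y) → x ≤ y
  Ack-sandwich⇒≤ a p q = ≤-pred (Ack-cancelʳ-< a (≤-<-trans p q))

  lastVal-take-≥ : ∀ {m prev} s → SandwichFrom k m prev s → ∀ j → prev ≤ lastVal k prev (take j s)
  lastVal-take-≥ s               _ zero    = ≤-refl
  lastVal-take-≥ []              _ (suc j) = ≤-refl
  lastVal-take-≥ {prev = prev} ((a , b) ∷ s) ((Aprev≤m , _) , (_ , m<Aab+1) , sw) (suc j) = begin
    prev                                ≤⟨ n≤Ack a _ ⟩
    A a prev                            ≤⟨ Ack-monoʳ-≤ a (Ack-sandwich⇒≤ a Aprev≤m m<Aab+1) ⟩
    A a b                               ≤⟨ lastVal-take-≥ s sw j ⟩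
    lastVal k (A a b) (take j s)        ∎
    where open ≤-Reasoning

  sandwich-upper-antitone : ∀ {m prev a b a₂ b₂ s} →
    SandwichFrom k m prev ((a , b) ∷ (a₂ , b₂) ∷ s) → A a₂ (suc b₂) ≤ A a (suc b)
  sandwich-upper-antitone {a = a} {b} {a₂}
    (_ , (_ , m<Aab+1) , _ , (A₂b₂≤m , _) , _) with a₂ ≤? a
  ... | yes a₂≤a with Ack-image-antitone a₂≤a (suc b)
  ...   | y , eq rewrite eq = Ack-<⇒suc-≤ a₂ (≤-<-trans A₂b₂≤m m<Aab+1)
  sandwich-upper-antitone {m} {a = a} {b} {a₂}
    (_ , (_ , m<Aab+1) , (A₂Aab≤m , _) , _) | no a₂≰a =
    contradiction m<Aab+1 (≤⇒≯ (begin
      A a (suc b)       ≤⟨ Ack-suc-≤-suc-level a b ⟩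
      A (suc a) (A a b) ≤⟨ Ack-monoˡ-≤ (≰⇒> a₂≰a) _ ⟩
      A a₂ (A a b)      ≤⟨ A₂Aab≤m ⟩
      m                 ∎))
    where open ≤-Reasoning

  BelowLastUpper : ℕ → List (ℕ × ℕ) → Set
  BelowLastUpper w t = ∀ pre a b → t ≡ pre ++ [ (a , b) ] → w < A a (suc b)

  BelowLastUpper-tail : ∀ {w x t} → BelowLastUpper w (x ∷ t) → BelowLastUpper w t
  BelowLastUpper-tail {x = x} below pre a b eq = below (x ∷ pre) a b (cong (x ∷_) eq)

  sandwich-head-upper : ∀ {m prev a b w} s j → SandwichFrom k m prev ((a , b) ∷ s) →
    BelowLastUpper w (take (suc j) ((a , b) ∷ s)) → w < A a (suc b)
  sandwich-head-upper {a = a} {b} s              zero    _  below = below [] a b refl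
  sandwich-head-upper {a = a} {b} []             (suc j) _  below = below [] a b refl
  sandwich-head-upper {a = a} {b} ((a₂ , b₂) ∷ s) (suc j) sw@(_ , _ , sw′) below =
    <-≤-trans (sandwich-head-upper s j sw′ (BelowLastUpper-tail below))
              (sandwich-upper-antitone {a = a} {b} {a₂} {b₂} sw)

  sandwich-extend : ∀ {m prev} d e s j → SandwichFrom k m prev s →
    A d (lastVal k prev (take j s)) ≤ A d e →
    A d e < A (suc d) (lastVal k prev (take j s)) →
    BelowLastUpper (A d e) (take j s) →
    SandwichFrom k (A d e) prev (take j s ++ [ (d , e) ])
  sandwich-extend d e s zero _ lower upper _ =
    (lower , upper) , (≤-refl , Ack-<-suc d e) , n<Ack 0 (A d e)
  sandwich-extend d e [] (suc j) _ lower upper _ =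
    (lower , upper) , (≤-refl , Ack-<-suc d e) , n<Ack 0 (A d e)
  sandwich-extend {prev = prev} d e ((a , b) ∷ s) (suc j)
    sw@((Aprev≤m , m<A′prev) , (Aab≤m , m<Aab+1) , sw′) lower upper below =
    (Aprev≤w , w<A′prev) , (Aab≤w , w<Aab+1) ,
    sandwich-extend d e s j sw′ lower upper (BelowLastUpper-tail below)
    where
    w<Aab+1 : A d e < A a (suc b)
    w<Aab+1 = sandwich-head-upper s j sw below

    Aab≤w : A a b ≤ A d e
    Aab≤w = ≤-trans (lastVal-take-≥ s sw′ j) (≤-trans (n≤Ack d _) lower)

    Aprev≤w : A a prev ≤ A d e
    Aprev≤w = ≤-trans (Ack-monoʳ-≤ a (Ack-sandwich⇒≤ a Aprev≤m m<Aab+1)) Aab≤w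

    w<A′prev : A d e < A (suc a) prev
    w<A′prev = <-≤-trans w<Aab+1 (Ack-<-suc-level⇒suc-≤ a {b} {prev} (≤-<-trans Aab≤m m<A′prev))

proposition3p4 : (k : ℕ) → 2 ≤ k →
    (m a b : ℕ) (s : List (ℕ × ℕ)) →
    0 < m → m ≡ Ack k a b →
    (pre₀ : List (ℕ × ℕ)) → s ≡ pre₀ ++ [ (a , b) ] →
    IsSandwichSeq k m s →
    (j : ℕ) → j ≤ length s →
    (d e : ℕ) →
    Ack k d (lastVal k 0 (take j s)) ≤ Ack k d e →
    Ack k d e < Ack k (suc d) (lastVal k 0 (take j s)) →
    ((pre : List (ℕ × ℕ)) (aj bj : ℕ) → take j s ≡ pre ++ [ (aj , bj) ] →
      Ack k d e < Ack k aj (suc bj)) →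
    NormalForm k (Ack k d e) d e 0 ×
    IsSandwichSeq k (Ack k d e) (take j s ++ [ (d , e) ])
proposition3p4 k 1<k _ _ _ s _ _ _ _ (_ , sandwich) j _ d e lower upper below =
  (≤-<-trans z≤n (n<Ack 1<k d e) , sym (+-identityʳ _) , take j s , w-sandwich) , w-sandwich
  where
  w-sandwich : IsSandwichSeq k (Ack k d e) (take j s ++ [ (d , e) ])
  w-sandwich = (λ eq → case ++-conicalʳ (take j s) _ eq of λ ())
             , sandwich-extend 1<k d e s j sandwich lower upper below
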